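{- For all integers $n,p,m\geq0$, \[ B_{n+m,p}=(p+1)\sum_{k=0}^{m}\left\{{m+p\atop k+p}\right\}_{p}\frac{(-1)^{k}(p+1)_{k}}{k+p+1}\,B_{n,p+k}. \] For all integers $n,r\geq1$ and $p\geq0$, \[ B_{n,p+r}=\frac{r(p+r+1)}{(r+1)(r)_{p+1}}\sum_{k=0}^{p}\left[{p+r\atop k+r}\right]_{r}(-1)^{k}B_{n+k,r}. \]
   Context: The $p$-Bernoulli numbers $B_{n,p}$ are defined by $\sum_{n\ge0}B_{n,p}\frac{t^{n}}{n!}={}_{2}F_{1}(1,1;p+2;1-e^{t})$, where ${}_2F_1(a,b;c;z)=\sum_{k\ge0}\frac{(a)_k(b)_k}{(c)_k}\frac{z^k}{k!}$ and $(x)_{k}=x(x+1)\cdots(x+k-1)$, $(x)_0=1$. The $r$-Stirling numbers of the second kind are defined by $\frac{(e^{t}-1)^{k}e^{pt}}{k!}=\sum_{m\geq k}\left\{{m+p\atop k+p}\right\}_{p}\frac{t^{m}}{m!}$ (zero for $k>m$); the $r$-Stirling numbers of the first kind by $(x+r)(x+r+1)\cdots(x+r+p-1)=\sum_{k=0}^{p}\left[{p+r\atop k+r}\right]_{r}x^{k}$. -}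

module Defs where

open import Data.Nat as ℕ using (ℕ; zero; suc)
open import Data.Nat.Combinatorics using (_C_)
open import Data.Integer using (+_)
open import Data.Rational using (ℚ; _+_; _*_; -_; _/_; 0ℚ; 1ℚ)
open import Data.List using (List; []; _∷_; map)

ℕ→ℚ : ℕ → ℚ
ℕ→ℚ n = + n / 1

-- 1/d for a positive natural d (only ever applied to positive arguments;
-- value at 0 is an irrelevant junk value 0)
inv : ℕ → ℚ
inv zero = 0ℚ
inv (suc d) = + 1 / suc d

sgn : ℕ → ℚ
sgn zero = 1ℚ
sgn (suc k) = - sgn k

sumTo : ℕ → (ℕ → ℚ) → ℚ
sumTo zero f = f 0
sumTo (suc n) f = sumTo n f + f (suc n)

poch : ℕ → ℕ → ℕ
poch x zero = 1
poch x (suc k) = poch x k ℕ.* (x ℕ.+ k)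

fact : ℕ → ℕ
fact zero = 1
fact (suc n) = suc n ℕ.* fact n

-- n! [t^n] (e^{t}-1)^k e^{qt}
--   = Σ_{j=0}^{k} C(k,j) (-1)^{k-j} (j+q)^n     (binomial expansion of (e^t-1)^k)
expCoeff : ℕ → ℕ → ℕ → ℚ
expCoeff q n k = sumTo k (λ j → ℕ→ℚ (k C j) * sgn (k ℕ.∸ j) * ℕ→ℚ ((j ℕ.+ q) ℕ.^ n))

-- p-Bernoulli numbers: B_{n,p} = n! [t^n] 2F1(1,1;p+2;1-e^t)
--   = Σ_k (1)_k (1)_k / ((p+2)_k k!) · n![t^n] (1-e^t)^k,
-- with (1-e^t)^k = (-1)^k (e^t-1)^k; terms k > n vanish since (e^t-1)^k = O(t^k).
pB : ℕ → ℕ → ℚ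
pB n p = sumTo n (λ k →
  ℕ→ℚ (poch 1 k ℕ.* poch 1 k) * inv (poch (p ℕ.+ 2) k ℕ.* fact k)
    * sgn k * expCoeff 0 n k)

-- r-Stirling numbers of the second kind {m+p, k+p}_p :
--   (e^t-1)^k e^{pt} / k! = Σ_m {m+p, k+p}_p t^m/m!
stir2 : ℕ → ℕ → ℕ → ℚ
stir2 p m k = inv (fact k) * expCoeff p m k

addL : List ℕ → List ℕ → List ℕ
addL [] ys = ys
addL (x ∷ xs) [] = x ∷ xs
addL (x ∷ xs) (y ∷ ys) = (x ℕ.+ y) ∷ addL xs ys

-- multiply a coefficient list (constant term first) by (x + c): x·P + c·P
mulLin : ℕ → List ℕ → List ℕ
mulLin c P = addL (0 ∷ P) (map (c ℕ.*_) P)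

risingPoly : ℕ → ℕ → List ℕ
risingPoly r zero = 1 ∷ []
risingPoly r (suc p) = mulLin (r ℕ.+ p) (risingPoly r p)

coeff : List ℕ → ℕ → ℕ
coeff [] k = 0
coeff (a ∷ as) zero = a
coeff (a ∷ as) (suc k) = coeff as k

-- r-Stirling numbers of the first kind [p+r, k+r]_r :
--   (x+r)(x+r+1)...(x+r+p-1) = Σ_k [p+r, k+r]_r x^k
stir1 : ℕ → ℕ → ℕ → ℚ
stir1 r p k = ℕ→ℚ (coeff (risingPoly r p) k)

-- Everything rests on the three-term recurrence  B_{n+1,p} = p B_{n,p} − κ_p B_{n,p+1}
-- with κ_p = (p+1)²/(p+2).  Writing B_{n,p} = Σ_k a_{p,k} (−1)^k E(n,k) with
-- a_{p,k} = k!/(p+2)_k and E(n,k) = n![tⁿ](eᵗ−1)ᵏ, it follows from the Stirling recurrence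
-- E(n+1,k) = k E(n,k) + k E(n,k−1) together with the contiguous relation
-- k a_{p,k} − (k+1) a_{p,k+1} = p a_{p,k} − κ_p a_{p+1,k}.
--
-- The first identity is proved by induction on m: expanding every B_{n+1,p+k} with the
-- recurrence and regrouping by {m+1+p, k+p}_p = (k+p) {m+p, k+p}_p + {m+p, k−1+p}_p turns the
-- sum for (n+1, m) into the sum for (n, m+1).  For the second, the alternating sums
-- T_p(n) = Σ_k [p+r, k+r]_r (−1)^k B_{n+k,r} satisfy T_{p+1}(n) = (r+p) T_p(n) − T_p(n+1) by
-- the recurrence of the r-Stirling numbers of the first kind, so the three-term recurrence
-- gives T_p(n) = κ_r κ_{r+1} ⋯ κ_{r+p−1} B_{n,p+r}, a product that telescopes to
-- (r+1)(r)_{p+1} / (r(p+r+1)).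
module Submission where

open import Defs
open import Data.Nat as ℕ using (ℕ; zero; suc; NonZero; _≤_; _<_; z≤n; s≤s)
import Data.Nat.Properties as ℕP
open import Data.Nat.Combinatorics using (_C_; k>n⇒nCk≡0; nCk+nC[k+1]≡[n+1]C[k+1])
import Data.Integer as ℤ
import Data.Integer.Properties as ℤP
open import Data.Rational using (ℚ; _+_; _*_; -_; _-_; 0ℚ; 1ℚ; toℚᵘ)
import Data.Rational.Properties as ℚP
open import Data.Rational.Unnormalised as ℚᵘ using (mkℚᵘ; *≡*)
import Data.Rational.Unnormalised.Properties as ℚᵘP
open import Data.Rational.Solver using (module +-*-Solver)
open import Data.List using ([]; _∷_; map)
open import Data.Product using (_×_; _,_)
open import Relation.Binary.PropositionalEquality
  using (_≡_; refl; sym; trans; cong; cong₂; subst; module ≡-Reasoning)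

open +-*-Solver

-- Identities between casts are checked in ℚᵘ, where ℕ→ℚ n and inv (suc d) are the
-- fractions n/1 and 1/(suc d) on the nose and no gcd normalisation gets in the way.
ℕ→ℚ-toℚᵘ : ∀ n → toℚᵘ (ℕ→ℚ n) ℚᵘ.≃ mkℚᵘ (ℤ.+ n) 0
ℕ→ℚ-toℚᵘ n = ℚP.toℚᵘ-fromℚᵘ (mkℚᵘ (ℤ.+ n) 0)

inv-toℚᵘ : ∀ d → toℚᵘ (inv (suc d)) ℚᵘ.≃ mkℚᵘ (ℤ.+ 1) d
inv-toℚᵘ d = ℚP.toℚᵘ-fromℚᵘ (mkℚᵘ (ℤ.+ 1) d)

ℕ→ℚ-+ : ∀ m n → ℕ→ℚ (m ℕ.+ n) ≡ ℕ→ℚ m + ℕ→ℚ n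
ℕ→ℚ-+ m n = ℚP.toℚᵘ-injective (begin
  toℚᵘ (ℕ→ℚ (m ℕ.+ n))                ≈⟨ ℕ→ℚ-toℚᵘ (m ℕ.+ n) ⟩
  mkℚᵘ (ℤ.+ (m ℕ.+ n)) 0               ≈⟨ *≡* (cong (ℤ._* ℤ.+ 1) (trans (ℤP.pos-+ m n) numerators)) ⟩
  mkℚᵘ (ℤ.+ m) 0 ℚᵘ.+ mkℚᵘ (ℤ.+ n) 0   ≈⟨ ℚᵘP.+-cong (ℕ→ℚ-toℚᵘ m) (ℕ→ℚ-toℚᵘ n) ⟨
  toℚᵘ (ℕ→ℚ m) ℚᵘ.+ toℚᵘ (ℕ→ℚ n)      ≈⟨ ℚP.toℚᵘ-homo-+ (ℕ→ℚ m) (ℕ→ℚ n) ⟨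
  toℚᵘ (ℕ→ℚ m + ℕ→ℚ n)                ∎)
  where
  open ℚᵘP.≃-Reasoning
  numerators : ℤ.+ m ℤ.+ ℤ.+ n ≡ ℤ.+ m ℤ.* ℤ.+ 1 ℤ.+ ℤ.+ n ℤ.* ℤ.+ 1
  numerators = sym (cong₂ ℤ._+_ (ℤP.*-identityʳ (ℤ.+ m)) (ℤP.*-identityʳ (ℤ.+ n)))

ℕ→ℚ-* : ∀ m n → ℕ→ℚ (m ℕ.* n) ≡ ℕ→ℚ m * ℕ→ℚ n
ℕ→ℚ-* m n = ℚP.toℚᵘ-injective (begin
  toℚᵘ (ℕ→ℚ (m ℕ.* n))                ≈⟨ ℕ→ℚ-toℚᵘ (m ℕ.* n) ⟩
  mkℚᵘ (ℤ.+ (m ℕ.* n)) 0               ≈⟨ *≡* (cong (ℤ._* ℤ.+ 1) (ℤP.pos-* m n)) ⟩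
  mkℚᵘ (ℤ.+ m) 0 ℚᵘ.* mkℚᵘ (ℤ.+ n) 0   ≈⟨ ℚᵘP.*-cong (ℕ→ℚ-toℚᵘ m) (ℕ→ℚ-toℚᵘ n) ⟨
  toℚᵘ (ℕ→ℚ m) ℚᵘ.* toℚᵘ (ℕ→ℚ n)      ≈⟨ ℚP.toℚᵘ-homo-* (ℕ→ℚ m) (ℕ→ℚ n) ⟨
  toℚᵘ (ℕ→ℚ m * ℕ→ℚ n)                ∎)
  where open ℚᵘP.≃-Reasoning

ℕ→ℚ-suc : ∀ n → ℕ→ℚ (suc n) ≡ 1ℚ + ℕ→ℚ n
ℕ→ℚ-suc = ℕ→ℚ-+ 1

inv-* : ∀ m n → inv (m ℕ.* n) ≡ inv m * inv n
inv-* zero    n       = sym (ℚP.*-zeroˡ (inv n))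
inv-* (suc m) zero    = trans (cong inv (ℕP.*-zeroʳ (suc m))) (sym (ℚP.*-zeroʳ (inv (suc m))))
inv-* (suc m) (suc n) = ℚP.toℚᵘ-injective (begin
  toℚᵘ (inv (suc m ℕ.* suc n))                 ≈⟨ inv-toℚᵘ (n ℕ.+ m ℕ.* suc n) ⟩
  mkℚᵘ (ℤ.+ 1) (n ℕ.+ m ℕ.* suc n)             ≈⟨ *≡* (cong (ℤ.+ 1 ℤ.*_) (ℤP.pos-* (suc m) (suc n))) ⟩
  mkℚᵘ (ℤ.+ 1) m ℚᵘ.* mkℚᵘ (ℤ.+ 1) n           ≈⟨ ℚᵘP.*-cong (inv-toℚᵘ m) (inv-toℚᵘ n) ⟨
  toℚᵘ (inv (suc m)) ℚᵘ.* toℚᵘ (inv (suc n))   ≈⟨ ℚP.toℚᵘ-homo-* (inv (suc m)) (inv (suc n)) ⟨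
  toℚᵘ (inv (suc m) * inv (suc n))             ∎)
  where open ℚᵘP.≃-Reasoning

ℕ→ℚ*inv : ∀ n .{{_ : NonZero n}} → ℕ→ℚ n * inv n ≡ 1ℚ
ℕ→ℚ*inv (suc n) = ℚP.toℚᵘ-injective (begin
  toℚᵘ (ℕ→ℚ (suc n) * inv (suc n))             ≈⟨ ℚP.toℚᵘ-homo-* (ℕ→ℚ (suc n)) (inv (suc n)) ⟩
  toℚᵘ (ℕ→ℚ (suc n)) ℚᵘ.* toℚᵘ (inv (suc n))   ≈⟨ ℚᵘP.*-cong (ℕ→ℚ-toℚᵘ (suc n)) (inv-toℚᵘ n) ⟩
  mkℚᵘ (ℤ.+ suc n) 0 ℚᵘ.* mkℚᵘ (ℤ.+ 1) n       ≈⟨ ℚᵘP.*-inverseʳ (mkℚᵘ (ℤ.+ suc n) 0) ⟩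
  toℚᵘ 1ℚ                                      ∎)
  where open ℚᵘP.≃-Reasoning

open ≡-Reasoning

ℕ→ℚ*inv-* : ∀ m n .{{_ : NonZero n}} → ℕ→ℚ n * inv (m ℕ.* n) ≡ inv m
ℕ→ℚ*inv-* m n = begin
  ℕ→ℚ n * inv (m ℕ.* n)        ≡⟨ cong (ℕ→ℚ n *_) (inv-* m n) ⟩
  ℕ→ℚ n * (inv m * inv n)      ≡⟨ solve 3 (λ a b c → a :* (b :* c) := b :* (a :* c)) refl (ℕ→ℚ n) (inv m) (inv n) ⟩
  inv m * (ℕ→ℚ n * inv n)      ≡⟨ cong (inv m *_) (ℕ→ℚ*inv n) ⟩
  inv m * 1ℚ                   ≡⟨ ℚP.*-identityʳ (inv m) ⟩
  inv m                        ∎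

sumTo-cong : ∀ N {f g : ℕ → ℚ} → (∀ k → f k ≡ g k) → sumTo N f ≡ sumTo N g
sumTo-cong zero    f≡g = f≡g 0
sumTo-cong (suc N) f≡g = cong₂ _+_ (sumTo-cong N f≡g) (f≡g (suc N))

sumTo-cong-≤ : ∀ N {f g : ℕ → ℚ} → (∀ k → k ≤ N → f k ≡ g k) → sumTo N f ≡ sumTo N g
sumTo-cong-≤ zero    f≡g = f≡g 0 z≤n
sumTo-cong-≤ (suc N) f≡g =
  cong₂ _+_ (sumTo-cong-≤ N (λ k k≤N → f≡g k (ℕP.m≤n⇒m≤1+n k≤N))) (f≡g (suc N) ℕP.≤-refl)

sumTo-+ : ∀ N (f g : ℕ → ℚ) → sumTo N (λ k → f k + g k) ≡ sumTo N f + sumTo N g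
sumTo-+ zero    f g = refl
sumTo-+ (suc N) f g = begin
  sumTo N (λ k → f k + g k) + (f (suc N) + g (suc N))
    ≡⟨ cong (_+ (f (suc N) + g (suc N))) (sumTo-+ N f g) ⟩
  (sumTo N f + sumTo N g) + (f (suc N) + g (suc N))
    ≡⟨ solve 4 (λ a b c d → (a :+ b) :+ (c :+ d) := (a :+ c) :+ (b :+ d)) refl
         (sumTo N f) (sumTo N g) (f (suc N)) (g (suc N)) ⟩
  (sumTo N f + f (suc N)) + (sumTo N g + g (suc N))
    ∎

sumTo-neg : ∀ N (f : ℕ → ℚ) → sumTo N (λ k → - f k) ≡ - sumTo N f
sumTo-neg zero    f = refl
sumTo-neg (suc N) f =
  trans (cong (_+ - f (suc N)) (sumTo-neg N f)) (sym (ℚP.neg-distrib-+ (sumTo N f) (f (suc N))))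

sumTo-sub : ∀ N (f g : ℕ → ℚ) → sumTo N (λ k → f k - g k) ≡ sumTo N f - sumTo N g
sumTo-sub N f g = trans (sumTo-+ N f (λ k → - g k)) (cong (sumTo N f +_) (sumTo-neg N g))

sumTo-*ˡ : ∀ N (c : ℚ) (f : ℕ → ℚ) → sumTo N (λ k → c * f k) ≡ c * sumTo N f
sumTo-*ˡ zero    c f = refl
sumTo-*ˡ (suc N) c f =
  trans (cong (_+ c * f (suc N)) (sumTo-*ˡ N c f)) (sym (ℚP.*-distribˡ-+ c (sumTo N f) (f (suc N))))

sumTo-suc : ∀ N (f : ℕ → ℚ) → sumTo (suc N) f ≡ f 0 + sumTo N (λ k → f (suc k))
sumTo-suc zero    f = refl
sumTo-suc (suc N) f =
  trans (cong (_+ f (suc (suc N))) (sumTo-suc N f)) (ℚP.+-assoc (f 0) (sumTo N (λ k → f (suc k))) (f (suc (suc N))))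

sumTo-regroup : ∀ N (f g : ℕ → ℚ) → f (suc N) ≡ 0ℚ → g 0 ≡ 0ℚ →
                sumTo (suc N) (λ k → f k + g k) ≡ sumTo N (λ k → f k + g (suc k))
sumTo-regroup N f g f[1+N]≡0 g0≡0 = begin
  sumTo (suc N) (λ k → f k + g k)
    ≡⟨ sumTo-+ (suc N) f g ⟩
  (sumTo N f + f (suc N)) + sumTo (suc N) g
    ≡⟨ cong₂ (λ a b → (sumTo N f + a) + b) f[1+N]≡0 (sumTo-suc N g) ⟩
  (sumTo N f + 0ℚ) + (g 0 + sumTo N (λ k → g (suc k)))
    ≡⟨ cong (λ a → (sumTo N f + 0ℚ) + (a + sumTo N (λ k → g (suc k)))) g0≡0 ⟩
  (sumTo N f + 0ℚ) + (0ℚ + sumTo N (λ k → g (suc k)))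
    ≡⟨ solve 2 (λ a b → (a :+ con 0ℚ) :+ (con 0ℚ :+ b) := a :+ b) refl (sumTo N f) (sumTo N (λ k → g (suc k))) ⟩
  sumTo N f + sumTo N (λ k → g (suc k))
    ≡⟨ sumTo-+ N f (λ k → g (suc k)) ⟨
  sumTo N (λ k → f k + g (suc k))
    ∎

prev : (ℕ → ℚ) → ℕ → ℚ
prev f zero    = 0ℚ
prev f (suc k) = f k

iterDiff : ℕ → (ℕ → ℚ) → ℕ → ℚ
iterDiff k f q = sumTo k (λ j → ℕ→ℚ (k C j) * sgn (k ℕ.∸ j) * f (j ℕ.+ q))

iterDiff-suc : ∀ k f q → iterDiff (suc k) f q ≡ iterDiff k f (suc q) - iterDiff k f q
iterDiff-suc k f q = begin
  iterDiff (suc k) f q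
    ≡⟨ sumTo-suc k (term (suc k)) ⟩
  term (suc k) 0 + sumTo k (λ j → term (suc k) (suc j))
    ≡⟨ cong (term (suc k) 0 +_) (trans (sumTo-cong k pascal) (sumTo-+ k _ _)) ⟩
  term (suc k) 0 + (iterDiff k f (suc q) + sumTo k (λ j → upper (suc j)))
    ≡⟨ solve 3 (λ a b c → a :+ (b :+ c) := b :+ (a :+ c)) refl
         (term (suc k) 0) (iterDiff k f (suc q)) (sumTo k (λ j → upper (suc j))) ⟩
  iterDiff k f (suc q) + (upper 0 + sumTo k (λ j → upper (suc j)))
    ≡⟨ cong (iterDiff k f (suc q) +_) (sumTo-suc k upper) ⟨
  iterDiff k f (suc q) + (sumTo k upper + upper (suc k))
    ≡⟨ cong₂ (λ a b → iterDiff k f (suc q) + (a + b))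
         (trans (sumTo-cong-≤ k upper≡-term) (sumTo-neg k (term k))) upper-top ⟩
  iterDiff k f (suc q) + (- iterDiff k f q + 0ℚ)
    ≡⟨ cong (iterDiff k f (suc q) +_) (ℚP.+-identityʳ (- iterDiff k f q)) ⟩
  iterDiff k f (suc q) - iterDiff k f q
    ∎
  where
  term : ℕ → ℕ → ℚ
  term k j = ℕ→ℚ (k C j) * sgn (k ℕ.∸ j) * f (j ℕ.+ q)
  upper : ℕ → ℚ
  upper j = ℕ→ℚ (k C j) * sgn (suc k ℕ.∸ j) * f (j ℕ.+ q)

  pascal : ∀ j → term (suc k) (suc j)
                 ≡ ℕ→ℚ (k C j) * sgn (k ℕ.∸ j) * f (j ℕ.+ suc q) + upper (suc j)
  pascal j = begin
    ℕ→ℚ (suc k C suc j) * s * x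
      ≡⟨ cong (λ c → ℕ→ℚ c * s * x) (nCk+nC[k+1]≡[n+1]C[k+1] k j) ⟨
    ℕ→ℚ (k C j ℕ.+ k C suc j) * s * x
      ≡⟨ cong (λ c → c * s * x) (ℕ→ℚ-+ (k C j) (k C suc j)) ⟩
    (ℕ→ℚ (k C j) + ℕ→ℚ (k C suc j)) * s * x
      ≡⟨ solve 4 (λ a b s x → (a :+ b) :* s :* x := a :* s :* x :+ b :* s :* x) refl
           (ℕ→ℚ (k C j)) (ℕ→ℚ (k C suc j)) s x ⟩
    ℕ→ℚ (k C j) * s * x + upper (suc j)
      ≡⟨ cong (λ i → ℕ→ℚ (k C j) * s * f i + upper (suc j)) (ℕP.+-suc j q) ⟨
    ℕ→ℚ (k C j) * s * f (j ℕ.+ suc q) + upper (suc j)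
      ∎
    where
    s = sgn (k ℕ.∸ j)
    x = f (suc j ℕ.+ q)

  upper≡-term : ∀ j → j ≤ k → upper j ≡ - term k j
  upper≡-term j j≤k = begin
    ℕ→ℚ (k C j) * sgn (suc k ℕ.∸ j) * f (j ℕ.+ q)
      ≡⟨ cong (λ i → ℕ→ℚ (k C j) * sgn i * f (j ℕ.+ q)) (ℕP.+-∸-assoc 1 j≤k) ⟩
    ℕ→ℚ (k C j) * - sgn (k ℕ.∸ j) * f (j ℕ.+ q)
      ≡⟨ solve 3 (λ c s x → c :* (:- s) :* x := :- (c :* s :* x)) refl
           (ℕ→ℚ (k C j)) (sgn (k ℕ.∸ j)) (f (j ℕ.+ q)) ⟩
    - term k j
      ∎

  upper-top : upper (suc k) ≡ 0ℚ
  upper-top = begin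
    ℕ→ℚ (k C suc k) * sgn (suc k ℕ.∸ suc k) * f (suc k ℕ.+ q)
      ≡⟨ cong (λ c → ℕ→ℚ c * sgn (k ℕ.∸ k) * f (suc k ℕ.+ q)) (k>n⇒nCk≡0 (ℕP.n<1+n k)) ⟩
    0ℚ * sgn (k ℕ.∸ k) * f (suc k ℕ.+ q)
      ≡⟨ solve 2 (λ s x → con 0ℚ :* s :* x := con 0ℚ) refl (sgn (k ℕ.∸ k)) (f (suc k ℕ.+ q)) ⟩
    0ℚ
      ∎

expCoeff-Δ : ∀ q n k → expCoeff q n (suc k) ≡ expCoeff (suc q) n k - expCoeff q n k
expCoeff-Δ q n k = iterDiff-suc k (λ x → ℕ→ℚ (x ℕ.^ n)) q

expCoeff-zero : ∀ q n → expCoeff q n 0 ≡ ℕ→ℚ (q ℕ.^ n)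
expCoeff-zero q n = ℚP.*-identityˡ (ℕ→ℚ (q ℕ.^ n))

expCoeff-suc : ∀ q n k →
  expCoeff q (suc n) k ≡ ℕ→ℚ (k ℕ.+ q) * expCoeff q n k + ℕ→ℚ k * prev (expCoeff q n) k
expCoeff-suc q n zero = begin
  expCoeff q (suc n) 0           ≡⟨ expCoeff-zero q (suc n) ⟩
  ℕ→ℚ (q ℕ.* q ℕ.^ n)           ≡⟨ ℕ→ℚ-* q (q ℕ.^ n) ⟩
  ℕ→ℚ q * ℕ→ℚ (q ℕ.^ n)         ≡⟨ cong (ℕ→ℚ q *_) (expCoeff-zero q n) ⟨
  ℕ→ℚ q * expCoeff q n 0        ≡⟨ ℚP.+-identityʳ _ ⟨
  ℕ→ℚ q * expCoeff q n 0 + 0ℚ   ∎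
expCoeff-suc q n (suc k) = begin
  expCoeff q (suc n) (suc k)
    ≡⟨ expCoeff-Δ q (suc n) k ⟩
  expCoeff (suc q) (suc n) k - expCoeff q (suc n) k
    ≡⟨ cong₂ _-_ (expCoeff-suc (suc q) n k) (expCoeff-suc q n k) ⟩
  (ℕ→ℚ (k ℕ.+ suc q) * E′ + K * D′) - (ℕ→ℚ (k ℕ.+ q) * E + K * D)
    ≡⟨ cong₂ (λ a b → (a * E′ + K * D′) - (b * E + K * D)) k+1+q-expand (ℕ→ℚ-+ k q) ⟩
  ((1ℚ + (K + Q)) * E′ + K * D′) - ((K + Q) * E + K * D)
    ≡⟨ solve 6 (λ K Q E′ E D′ D → ((con 1ℚ :+ (K :+ Q)) :* E′ :+ K :* D′) :- ((K :+ Q) :* E :+ K :* D)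
                  := (con 1ℚ :+ (K :+ Q)) :* (E′ :- E) :+ E :+ K :* (D′ :- D)) refl K Q E′ E D′ D ⟩
  (1ℚ + (K + Q)) * (E′ - E) + E + K * (D′ - D)
    ≡⟨ cong₂ (λ a b → (1ℚ + (K + Q)) * a + E + b) (sym (expCoeff-Δ q n k)) (prev-Δ k) ⟩
  (1ℚ + (K + Q)) * expCoeff q n (suc k) + E + K * E
    ≡⟨ solve 4 (λ K Q X E → (con 1ℚ :+ (K :+ Q)) :* X :+ E :+ K :* E
                  := (con 1ℚ :+ K :+ Q) :* X :+ (con 1ℚ :+ K) :* E) refl K Q (expCoeff q n (suc k)) E ⟩
  (1ℚ + K + Q) * expCoeff q n (suc k) + (1ℚ + K) * E
    ≡⟨ cong₂ (λ a b → a * expCoeff q n (suc k) + b * E)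
         (sym (trans (ℕ→ℚ-+ (suc k) q) (cong (_+ Q) (ℕ→ℚ-suc k)))) (sym (ℕ→ℚ-suc k)) ⟩
  ℕ→ℚ (suc k ℕ.+ q) * expCoeff q n (suc k) + ℕ→ℚ (suc k) * E
    ∎
  where
  K = ℕ→ℚ k
  Q = ℕ→ℚ q
  E′ = expCoeff (suc q) n k
  E = expCoeff q n k
  D′ = prev (expCoeff (suc q) n) k
  D = prev (expCoeff q n) k

  k+1+q-expand : ℕ→ℚ (k ℕ.+ suc q) ≡ 1ℚ + (K + Q)
  k+1+q-expand = trans (cong ℕ→ℚ (ℕP.+-suc k q)) (trans (ℕ→ℚ-suc (k ℕ.+ q)) (cong (1ℚ +_) (ℕ→ℚ-+ k q)))

  -- the factor k is essential: at k = 0 the bracket is 0, while expCoeff q n 0 need not be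
  prev-Δ : ∀ k → ℕ→ℚ k * (prev (expCoeff (suc q) n) k - prev (expCoeff q n) k) ≡ ℕ→ℚ k * expCoeff q n k
  prev-Δ zero    = trans (ℚP.*-zeroˡ (0ℚ - 0ℚ)) (sym (ℚP.*-zeroˡ (expCoeff q n 0)))
  prev-Δ (suc k) = cong (ℕ→ℚ (suc k) *_) (sym (expCoeff-Δ q n k))

expCoeff-vanish : ∀ q n k → n < k → expCoeff q n k ≡ 0ℚ
expCoeff-vanish q zero (suc zero) _ = begin
  expCoeff q 0 1                          ≡⟨ expCoeff-Δ q 0 0 ⟩
  expCoeff (suc q) 0 0 - expCoeff q 0 0   ≡⟨ cong₂ _-_ (expCoeff-zero (suc q) 0) (expCoeff-zero q 0) ⟩
  1ℚ - 1ℚ                                 ≡⟨ ℚP.+-inverseʳ 1ℚ ⟩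
  0ℚ                                      ∎
expCoeff-vanish q zero (suc (suc k)) _ = begin
  expCoeff q 0 (suc (suc k))                            ≡⟨ expCoeff-Δ q 0 (suc k) ⟩
  expCoeff (suc q) 0 (suc k) - expCoeff q 0 (suc k)     ≡⟨ cong₂ _-_ (expCoeff-vanish (suc q) 0 (suc k) (s≤s z≤n))
                                                                        (expCoeff-vanish q 0 (suc k) (s≤s z≤n)) ⟩
  0ℚ - 0ℚ                                               ≡⟨ ℚP.+-inverseʳ 0ℚ ⟩
  0ℚ                                                    ∎
expCoeff-vanish q (suc n) (suc k) (s≤s n<k) = begin
  expCoeff q (suc n) (suc k)
    ≡⟨ expCoeff-suc q n (suc k) ⟩
  ℕ→ℚ (suc k ℕ.+ q) * expCoeff q n (suc k) + ℕ→ℚ (suc k) * expCoeff q n k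
    ≡⟨ cong₂ (λ a b → ℕ→ℚ (suc k ℕ.+ q) * a + ℕ→ℚ (suc k) * b)
         (expCoeff-vanish q n (suc k) (ℕP.m<n⇒m<1+n n<k)) (expCoeff-vanish q n k n<k) ⟩
  ℕ→ℚ (suc k ℕ.+ q) * 0ℚ + ℕ→ℚ (suc k) * 0ℚ
    ≡⟨ solve 2 (λ a b → a :* con 0ℚ :+ b :* con 0ℚ := con 0ℚ) refl (ℕ→ℚ (suc k ℕ.+ q)) (ℕ→ℚ (suc k)) ⟩
  0ℚ
    ∎

stir2-suc : ∀ p m k → stir2 p (suc m) k ≡ ℕ→ℚ (k ℕ.+ p) * stir2 p m k + prev (stir2 p m) k
stir2-suc p m zero =
  trans (cong (inv 1 *_) (expCoeff-suc p m 0))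
    (solve 4 (λ i P E E₀ → i :* (P :* E :+ con 0ℚ :* E₀) := P :* (i :* E) :+ con 0ℚ) refl
       (inv 1) (ℕ→ℚ p) (expCoeff p m 0) (prev (expCoeff p m) 0))
stir2-suc p m (suc k) = begin
  inv (suc k ℕ.* fact k) * expCoeff p (suc m) (suc k)
    ≡⟨ cong (inv (suc k ℕ.* fact k) *_) (expCoeff-suc p m (suc k)) ⟩
  inv (suc k ℕ.* fact k) * (A * X + ℕ→ℚ (suc k) * Y)
    ≡⟨ solve 4 (λ i A X Z → i :* (A :* X :+ Z) := A :* (i :* X) :+ i :* Z) refl
         (inv (suc k ℕ.* fact k)) A X (ℕ→ℚ (suc k) * Y) ⟩
  A * stir2 p m (suc k) + inv (suc k ℕ.* fact k) * (ℕ→ℚ (suc k) * Y)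
    ≡⟨ cong (A * stir2 p m (suc k) +_) (solve 3 (λ i K Y → i :* (K :* Y) := K :* i :* Y) refl
         (inv (suc k ℕ.* fact k)) (ℕ→ℚ (suc k)) Y) ⟩
  A * stir2 p m (suc k) + ℕ→ℚ (suc k) * inv (suc k ℕ.* fact k) * Y
    ≡⟨ cong (λ c → A * stir2 p m (suc k) + c * Y)
         (trans (cong (ℕ→ℚ (suc k) *_) (cong inv (ℕP.*-comm (suc k) (fact k)))) (ℕ→ℚ*inv-* (fact k) (suc k))) ⟩
  A * stir2 p m (suc k) + stir2 p m k
    ∎
  where
  A = ℕ→ℚ (suc k ℕ.+ p)
  X = expCoeff p m (suc k)
  Y = expCoeff p m k

stir2-vanish : ∀ p m k → m < k → stir2 p m k ≡ 0ℚ
stir2-vanish p m k m<k =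
  trans (cong (inv (fact k) *_) (expCoeff-vanish p m k m<k)) (ℚP.*-zeroʳ (inv (fact k)))

coeff-addL : ∀ xs ys k → coeff (addL xs ys) k ≡ coeff xs k ℕ.+ coeff ys k
coeff-addL []       ys       k       = refl
coeff-addL (x ∷ xs) []       k       = sym (ℕP.+-identityʳ (coeff (x ∷ xs) k))
coeff-addL (x ∷ xs) (y ∷ ys) zero    = refl
coeff-addL (x ∷ xs) (y ∷ ys) (suc k) = coeff-addL xs ys k

coeff-map-* : ∀ c xs k → coeff (map (c ℕ.*_) xs) k ≡ c ℕ.* coeff xs k
coeff-map-* c []       k       = sym (ℕP.*-zeroʳ c)
coeff-map-* c (x ∷ xs) zero    = refl
coeff-map-* c (x ∷ xs) (suc k) = coeff-map-* c xs k

coeff-mulLin-zero : ∀ c xs → coeff (mulLin c xs) 0 ≡ c ℕ.* coeff xs 0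
coeff-mulLin-zero c xs = trans (coeff-addL (0 ∷ xs) (map (c ℕ.*_) xs) 0) (coeff-map-* c xs 0)

coeff-mulLin-suc : ∀ c xs k → coeff (mulLin c xs) (suc k) ≡ coeff xs k ℕ.+ c ℕ.* coeff xs (suc k)
coeff-mulLin-suc c xs k =
  trans (coeff-addL (0 ∷ xs) (map (c ℕ.*_) xs) (suc k)) (cong (coeff xs k ℕ.+_) (coeff-map-* c xs (suc k)))

risingPoly-vanish : ∀ r p k → p < k → coeff (risingPoly r p) k ≡ 0
risingPoly-vanish r zero    (suc k) _         = refl
risingPoly-vanish r (suc p) (suc k) (s≤s p<k) = begin
  coeff (risingPoly r (suc p)) (suc k)
    ≡⟨ coeff-mulLin-suc (r ℕ.+ p) (risingPoly r p) k ⟩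
  coeff (risingPoly r p) k ℕ.+ (r ℕ.+ p) ℕ.* coeff (risingPoly r p) (suc k)
    ≡⟨ cong₂ (λ a b → a ℕ.+ (r ℕ.+ p) ℕ.* b)
         (risingPoly-vanish r p k p<k) (risingPoly-vanish r p (suc k) (ℕP.m<n⇒m<1+n p<k)) ⟩
  (r ℕ.+ p) ℕ.* 0
    ≡⟨ ℕP.*-zeroʳ (r ℕ.+ p) ⟩
  0
    ∎

stir1-suc : ∀ r p k → stir1 r (suc p) k ≡ ℕ→ℚ (r ℕ.+ p) * stir1 r p k + prev (stir1 r p) k
stir1-suc r p zero = begin
  ℕ→ℚ (coeff (risingPoly r (suc p)) 0)                ≡⟨ cong ℕ→ℚ (coeff-mulLin-zero (r ℕ.+ p) (risingPoly r p)) ⟩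
  ℕ→ℚ ((r ℕ.+ p) ℕ.* coeff (risingPoly r p) 0)        ≡⟨ ℕ→ℚ-* (r ℕ.+ p) (coeff (risingPoly r p) 0) ⟩
  ℕ→ℚ (r ℕ.+ p) * stir1 r p 0                         ≡⟨ ℚP.+-identityʳ _ ⟨
  ℕ→ℚ (r ℕ.+ p) * stir1 r p 0 + 0ℚ                    ∎
stir1-suc r p (suc k) = begin
  ℕ→ℚ (coeff (risingPoly r (suc p)) (suc k))
    ≡⟨ cong ℕ→ℚ (coeff-mulLin-suc (r ℕ.+ p) (risingPoly r p) k) ⟩
  ℕ→ℚ (coeff (risingPoly r p) k ℕ.+ (r ℕ.+ p) ℕ.* coeff (risingPoly r p) (suc k))
    ≡⟨ ℕ→ℚ-+ (coeff (risingPoly r p) k) _ ⟩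
  stir1 r p k + ℕ→ℚ ((r ℕ.+ p) ℕ.* coeff (risingPoly r p) (suc k))
    ≡⟨ cong (stir1 r p k +_) (ℕ→ℚ-* (r ℕ.+ p) (coeff (risingPoly r p) (suc k))) ⟩
  stir1 r p k + ℕ→ℚ (r ℕ.+ p) * stir1 r p (suc k)
    ≡⟨ ℚP.+-comm (stir1 r p k) _ ⟩
  ℕ→ℚ (r ℕ.+ p) * stir1 r p (suc k) + stir1 r p k
    ∎

stir1-vanish : ∀ r p k → p < k → stir1 r p k ≡ 0ℚ
stir1-vanish r p k p<k = cong ℕ→ℚ (risingPoly-vanish r p k p<k)

κ : ℕ → ℚ
κ p = ℕ→ℚ (suc p) * ℕ→ℚ (suc p) * inv (suc (suc p))

pBCoeff : ℕ → ℕ → ℚ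
pBCoeff p k = ℕ→ℚ (poch 1 k ℕ.* poch 1 k) * inv (poch (p ℕ.+ 2) k ℕ.* fact k)

poch-1 : ∀ k → poch 1 k ≡ fact k
poch-1 zero    = refl
poch-1 (suc k) = trans (cong (ℕ._* suc k) (poch-1 k)) (ℕP.*-comm (fact k) (suc k))

poch-suc-shift : ∀ x k → poch x (suc k) ≡ x ℕ.* poch (suc x) k
poch-suc-shift x zero    = trans (ℕP.*-identityˡ (x ℕ.+ 0)) (trans (ℕP.+-identityʳ x) (sym (ℕP.*-identityʳ x)))
poch-suc-shift x (suc k) = begin
  poch x (suc k) ℕ.* (x ℕ.+ suc k)              ≡⟨ cong₂ ℕ._*_ (poch-suc-shift x k) (ℕP.+-suc x k) ⟩
  x ℕ.* poch (suc x) k ℕ.* suc (x ℕ.+ k)        ≡⟨ ℕP.*-assoc x (poch (suc x) k) (suc x ℕ.+ k) ⟩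
  x ℕ.* poch (suc x) (suc k)                    ∎

fact-nonZero : ∀ k → NonZero (fact k)
fact-nonZero zero    = _
fact-nonZero (suc k) = ℕP.m*n≢0 (suc k) (fact k) {{_}} {{fact-nonZero k}}

poch-suc-nonZero : ∀ x k → NonZero (poch (suc x) k)
poch-suc-nonZero x zero    = _
poch-suc-nonZero x (suc k) = ℕP.m*n≢0 (poch (suc x) k) (suc x ℕ.+ k) {{poch-suc-nonZero x k}}

pBCoeff-closed : ∀ p k → pBCoeff p k ≡ ℕ→ℚ (fact k) * inv (poch (p ℕ.+ 2) k)
pBCoeff-closed p k = begin
  ℕ→ℚ (poch 1 k ℕ.* poch 1 k) * inv (D ℕ.* fact k)
    ≡⟨ cong (λ f → ℕ→ℚ (f ℕ.* f) * inv (D ℕ.* fact k)) (poch-1 k) ⟩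
  ℕ→ℚ (fact k ℕ.* fact k) * inv (D ℕ.* fact k)
    ≡⟨ cong (_* inv (D ℕ.* fact k)) (ℕ→ℚ-* (fact k) (fact k)) ⟩
  ℕ→ℚ (fact k) * ℕ→ℚ (fact k) * inv (D ℕ.* fact k)
    ≡⟨ ℚP.*-assoc (ℕ→ℚ (fact k)) (ℕ→ℚ (fact k)) (inv (D ℕ.* fact k)) ⟩
  ℕ→ℚ (fact k) * (ℕ→ℚ (fact k) * inv (D ℕ.* fact k))
    ≡⟨ cong (ℕ→ℚ (fact k) *_) (ℕ→ℚ*inv-* D (fact k) {{fact-nonZero k}}) ⟩
  ℕ→ℚ (fact k) * inv D
    ∎
  where D = poch (p ℕ.+ 2) k

pBCoeff-contiguous : ∀ p k →
  ℕ→ℚ k * pBCoeff p k - ℕ→ℚ (suc k) * pBCoeff p (suc k) ≡ ℕ→ℚ p * pBCoeff p k - κ p * pBCoeff (suc p) k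
pBCoeff-contiguous p k = begin
  K * pBCoeff p k - ℕ→ℚ (suc k) * pBCoeff p (suc k)
    ≡⟨ cong₂ (λ a b → K * a - ℕ→ℚ (suc k) * b) at-k at-suc-k ⟩
  K * (ℕ→ℚ S * x) - ℕ→ℚ (suc k) * (ℕ→ℚ (suc k) * x)
    ≡⟨ cong₂ (λ s k₁ → K * (s * x) - k₁ * (k₁ * x)) S-expand (ℕ→ℚ-suc k) ⟩
  K * ((P + ℕ→ℚ 2 + K) * x) - (1ℚ + K) * ((1ℚ + K) * x)
    ≡⟨ solve 3 (λ K P x → K :* ((P :+ con (ℕ→ℚ 2) :+ K) :* x) :- (con 1ℚ :+ K) :* ((con 1ℚ :+ K) :* x)
                  := P :* ((P :+ con (ℕ→ℚ 2) :+ K) :* x) :- (con 1ℚ :+ P) :* (con 1ℚ :+ P) :* x) refl K P x ⟩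
  P * ((P + ℕ→ℚ 2 + K) * x) - (1ℚ + P) * (1ℚ + P) * x
    ≡⟨ cong₂ (λ s p₁ → P * (s * x) - p₁ * p₁ * x) (sym S-expand) (sym (ℕ→ℚ-suc p)) ⟩
  P * (ℕ→ℚ S * x) - ℕ→ℚ (suc p) * ℕ→ℚ (suc p) * x
    ≡⟨ cong₂ (λ a b → P * a - b) (sym at-k) (sym at-suc-p) ⟩
  P * pBCoeff p k - κ p * pBCoeff (suc p) k
    ∎
  where
  K = ℕ→ℚ k
  P = ℕ→ℚ p
  F = ℕ→ℚ (fact k)
  D = poch (p ℕ.+ 2) k
  S = p ℕ.+ 2 ℕ.+ k
  x = F * inv (poch (p ℕ.+ 2) (suc k))

  S-expand : ℕ→ℚ S ≡ P + ℕ→ℚ 2 + K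
  S-expand = trans (ℕ→ℚ-+ (p ℕ.+ 2) k) (cong (_+ K) (ℕ→ℚ-+ p 2))

  instance
    S-nonZero : NonZero S
    S-nonZero = subst NonZero (cong (ℕ._+ k) (ℕP.+-comm 2 p)) _

  at-k : pBCoeff p k ≡ ℕ→ℚ S * x
  at-k = begin
    pBCoeff p k
      ≡⟨ pBCoeff-closed p k ⟩
    F * inv D
      ≡⟨ cong (F *_) (ℕ→ℚ*inv-* D S) ⟨
    F * (ℕ→ℚ S * inv (D ℕ.* S))
      ≡⟨ solve 3 (λ F s i → F :* (s :* i) := s :* (F :* i)) refl F (ℕ→ℚ S) (inv (D ℕ.* S)) ⟩
    ℕ→ℚ S * x
      ∎

  at-suc-k : pBCoeff p (suc k) ≡ ℕ→ℚ (suc k) * x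
  at-suc-k = begin
    pBCoeff p (suc k)
      ≡⟨ pBCoeff-closed p (suc k) ⟩
    ℕ→ℚ (suc k ℕ.* fact k) * inv (poch (p ℕ.+ 2) (suc k))
      ≡⟨ cong (_* inv (poch (p ℕ.+ 2) (suc k))) (ℕ→ℚ-* (suc k) (fact k)) ⟩
    ℕ→ℚ (suc k) * F * inv (poch (p ℕ.+ 2) (suc k))
      ≡⟨ ℚP.*-assoc (ℕ→ℚ (suc k)) F (inv (poch (p ℕ.+ 2) (suc k))) ⟩
    ℕ→ℚ (suc k) * x
      ∎

  at-suc-p : κ p * pBCoeff (suc p) k ≡ ℕ→ℚ (suc p) * ℕ→ℚ (suc p) * x
  at-suc-p = begin
    κ p * pBCoeff (suc p) k
      ≡⟨ cong (κ p *_) (pBCoeff-closed (suc p) k) ⟩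
    P₁ * P₁ * inv (suc (suc p)) * (F * inv (poch (suc (p ℕ.+ 2)) k))
      ≡⟨ solve 4 (λ P₁ i F j → P₁ :* P₁ :* i :* (F :* j) := P₁ :* P₁ :* (F :* (i :* j))) refl
           P₁ (inv (suc (suc p))) F (inv (poch (suc (p ℕ.+ 2)) k)) ⟩
    P₁ * P₁ * (F * (inv (suc (suc p)) * inv (poch (suc (p ℕ.+ 2)) k)))
      ≡⟨ cong (λ i → P₁ * P₁ * (F * (i * inv (poch (suc (p ℕ.+ 2)) k)))) (cong inv (ℕP.+-comm 2 p)) ⟩
    P₁ * P₁ * (F * (inv (p ℕ.+ 2) * inv (poch (suc (p ℕ.+ 2)) k)))
      ≡⟨ cong (λ i → P₁ * P₁ * (F * i))
           (trans (sym (inv-* (p ℕ.+ 2) _)) (cong inv (sym (poch-suc-shift (p ℕ.+ 2) k)))) ⟩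
    P₁ * P₁ * x
      ∎
    where P₁ = ℕ→ℚ (suc p)

pB-suc : ∀ n p → pB (suc n) p ≡ ℕ→ℚ p * pB n p - κ p * pB n (suc p)
pB-suc n p = begin
  pB (suc n) p
    ≡⟨ sumTo-cong (suc n) split ⟩
  sumTo (suc n) (λ k → A k + B k)
    ≡⟨ sumTo-regroup n A B A-top (ℚP.*-zeroˡ (pBCoeff p 0 * sgn 0 * 0ℚ)) ⟩
  sumTo n (λ k → A k + B (suc k))
    ≡⟨ sumTo-cong n merge ⟩
  sumTo n (λ k → ℕ→ℚ p * t p k - κ p * t (suc p) k)
    ≡⟨ sumTo-sub n (λ k → ℕ→ℚ p * t p k) (λ k → κ p * t (suc p) k) ⟩
  sumTo n (λ k → ℕ→ℚ p * t p k) - sumTo n (λ k → κ p * t (suc p) k)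
    ≡⟨ cong₂ _-_ (sumTo-*ˡ n (ℕ→ℚ p) (t p)) (sumTo-*ˡ n (κ p) (t (suc p))) ⟩
  ℕ→ℚ p * pB n p - κ p * pB n (suc p)
    ∎
  where
  t : ℕ → ℕ → ℚ
  t p k = pBCoeff p k * sgn k * expCoeff 0 n k
  A B : ℕ → ℚ
  A k = ℕ→ℚ k * t p k
  B k = ℕ→ℚ k * (pBCoeff p k * sgn k * prev (expCoeff 0 n) k)

  split : ∀ k → pBCoeff p k * sgn k * expCoeff 0 (suc n) k ≡ A k + B k
  split k = begin
    pBCoeff p k * sgn k * expCoeff 0 (suc n) k
      ≡⟨ cong (pBCoeff p k * sgn k *_) (expCoeff-suc 0 n k) ⟩
    pBCoeff p k * sgn k * (ℕ→ℚ (k ℕ.+ 0) * expCoeff 0 n k + ℕ→ℚ k * prev (expCoeff 0 n) k)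
      ≡⟨ cong (λ i → pBCoeff p k * sgn k * (ℕ→ℚ i * expCoeff 0 n k + ℕ→ℚ k * prev (expCoeff 0 n) k))
           (ℕP.+-identityʳ k) ⟩
    pBCoeff p k * sgn k * (ℕ→ℚ k * expCoeff 0 n k + ℕ→ℚ k * prev (expCoeff 0 n) k)
      ≡⟨ solve 5 (λ a s K e e′ → a :* s :* (K :* e :+ K :* e′) := K :* (a :* s :* e) :+ K :* (a :* s :* e′)) refl
           (pBCoeff p k) (sgn k) (ℕ→ℚ k) (expCoeff 0 n k) (prev (expCoeff 0 n) k) ⟩
    A k + B k
      ∎

  A-top : A (suc n) ≡ 0ℚ
  A-top = begin
    ℕ→ℚ (suc n) * (pBCoeff p (suc n) * sgn (suc n) * expCoeff 0 n (suc n))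
      ≡⟨ cong (λ e → ℕ→ℚ (suc n) * (pBCoeff p (suc n) * sgn (suc n) * e))
           (expCoeff-vanish 0 n (suc n) (ℕP.n<1+n n)) ⟩
    ℕ→ℚ (suc n) * (pBCoeff p (suc n) * sgn (suc n) * 0ℚ)
      ≡⟨ solve 3 (λ K a s → K :* (a :* s :* con 0ℚ) := con 0ℚ) refl
           (ℕ→ℚ (suc n)) (pBCoeff p (suc n)) (sgn (suc n)) ⟩
    0ℚ
      ∎

  merge : ∀ k → A k + B (suc k) ≡ ℕ→ℚ p * t p k - κ p * t (suc p) k
  merge k = begin
    ℕ→ℚ k * (pBCoeff p k * sgn k * E) + ℕ→ℚ (suc k) * (pBCoeff p (suc k) * - sgn k * E)
      ≡⟨ solve 6 (λ K K₁ a a₁ s E → K :* (a :* s :* E) :+ K₁ :* (a₁ :* (:- s) :* E)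
                    := (K :* a :- K₁ :* a₁) :* s :* E) refl
           (ℕ→ℚ k) (ℕ→ℚ (suc k)) (pBCoeff p k) (pBCoeff p (suc k)) (sgn k) E ⟩
    (ℕ→ℚ k * pBCoeff p k - ℕ→ℚ (suc k) * pBCoeff p (suc k)) * sgn k * E
      ≡⟨ cong (λ c → c * sgn k * E) (pBCoeff-contiguous p k) ⟩
    (ℕ→ℚ p * pBCoeff p k - κ p * pBCoeff (suc p) k) * sgn k * E
      ≡⟨ solve 6 (λ P a c a′ s E → (P :* a :- c :* a′) :* s :* E := P :* (a :* s :* E) :- c :* (a′ :* s :* E)) refl
           (ℕ→ℚ p) (pBCoeff p k) (κ p) (pBCoeff (suc p) k) (sgn k) E ⟩
    ℕ→ℚ p * t p k - κ p * t (suc p) k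
      ∎
    where E = expCoeff 0 n k

inv*κ : ∀ q → inv (suc q) * κ q ≡ ℕ→ℚ (suc q) * inv (suc (suc q))
inv*κ q = begin
  inv (suc q) * (Y * Y * Z)     ≡⟨ solve 3 (λ i Y Z → i :* (Y :* Y :* Z) := Y :* i :* (Y :* Z)) refl (inv (suc q)) Y Z ⟩
  Y * inv (suc q) * (Y * Z)     ≡⟨ cong (_* (Y * Z)) (ℕ→ℚ*inv (suc q)) ⟩
  1ℚ * (Y * Z)                  ≡⟨ ℚP.*-identityˡ (Y * Z) ⟩
  Y * Z                         ∎
  where
  Y = ℕ→ℚ (suc q)
  Z = inv (suc (suc q))

stir2Summand : ℕ → (ℕ → ℚ) → ℕ → ℕ → ℚ
stir2Summand p c n k = c k * sgn k * ℕ→ℚ (poch (p ℕ.+ 1) k) * inv (k ℕ.+ p ℕ.+ 1) * pB n (p ℕ.+ k)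

stir2Summand-suc : ∀ p c n k →
  stir2Summand p c (suc n) k ≡ ℕ→ℚ (k ℕ.+ p) * stir2Summand p c n k + stir2Summand p (prev c) n (suc k)
stir2Summand-suc p c n k = begin
  c k * s * P * inv (k ℕ.+ p ℕ.+ 1) * pB (suc n) q
    ≡⟨ cong₂ (λ i b → c k * s * P * inv i * b) k+p+1≡1+q (pB-suc n q) ⟩
  c k * s * P * inv (suc q) * (ℕ→ℚ q * B - κ q * B′)
    ≡⟨ solve 8 (λ c s P I Q B κ B′ → c :* s :* P :* I :* (Q :* B :- κ :* B′)
                  := Q :* (c :* s :* P :* I :* B) :+ c :* (:- s) :* P :* (I :* κ) :* B′) refl
         (c k) s P (inv (suc q)) (ℕ→ℚ q) B (κ q) B′ ⟩
  ℕ→ℚ q * (c k * s * P * inv (suc q) * B) + c k * - s * P * (inv (suc q) * κ q) * B′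
    ≡⟨ cong₂ _+_ unshifted shifted ⟩
  ℕ→ℚ (k ℕ.+ p) * stir2Summand p c n k + stir2Summand p (prev c) n (suc k)
    ∎
  where
  q = p ℕ.+ k
  s = sgn k
  P = ℕ→ℚ (poch (p ℕ.+ 1) k)
  B = pB n q
  B′ = pB n (suc q)

  k+p+1≡1+q : k ℕ.+ p ℕ.+ 1 ≡ suc q
  k+p+1≡1+q = trans (ℕP.+-comm (k ℕ.+ p) 1) (cong suc (ℕP.+-comm k p))

  unshifted : ℕ→ℚ q * (c k * s * P * inv (suc q) * B) ≡ ℕ→ℚ (k ℕ.+ p) * stir2Summand p c n k
  unshifted = cong₂ (λ a i → ℕ→ℚ a * (c k * s * P * inv i * B)) (ℕP.+-comm p k) (sym k+p+1≡1+q)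

  shifted : c k * - s * P * (inv (suc q) * κ q) * B′ ≡ stir2Summand p (prev c) n (suc k)
  shifted = begin
    c k * - s * P * (inv (suc q) * κ q) * B′
      ≡⟨ cong (λ z → c k * - s * P * z * B′) (inv*κ q) ⟩
    c k * - s * P * (ℕ→ℚ (suc q) * inv (suc (suc q))) * B′
      ≡⟨ solve 6 (λ c s P Y Z B′ → c :* s :* P :* (Y :* Z) :* B′ := c :* s :* (P :* Y) :* Z :* B′) refl
           (c k) (- s) P (ℕ→ℚ (suc q)) (inv (suc (suc q))) B′ ⟩
    c k * - s * (P * ℕ→ℚ (suc q)) * inv (suc (suc q)) * B′
      ≡⟨ cong (λ y → c k * - s * y * inv (suc (suc q)) * B′) (sym P₁-expand) ⟩
    c k * - s * ℕ→ℚ (poch (p ℕ.+ 1) (suc k)) * inv (suc (suc q)) * B′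
      ≡⟨ cong₂ (λ i j → c k * - s * ℕ→ℚ (poch (p ℕ.+ 1) (suc k)) * inv (suc i) * pB n j)
           (sym k+p+1≡1+q) (sym (ℕP.+-suc p k)) ⟩
    stir2Summand p (prev c) n (suc k)
      ∎
    where
    P₁-expand : ℕ→ℚ (poch (p ℕ.+ 1) (suc k)) ≡ P * ℕ→ℚ (suc q)
    P₁-expand = trans (ℕ→ℚ-* (poch (p ℕ.+ 1) k) (p ℕ.+ 1 ℕ.+ k))
                      (cong (λ a → P * ℕ→ℚ a) (trans (ℕP.+-assoc p 1 k) (ℕP.+-suc p k)))

stir2Summand-vanish : ∀ p c n k → c k ≡ 0ℚ → stir2Summand p c n k ≡ 0ℚ
stir2Summand-vanish p c n k ck≡0 = begin
  c k * sgn k * P * I * B      ≡⟨ cong (λ a → a * sgn k * P * I * B) ck≡0 ⟩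
  0ℚ * sgn k * P * I * B       ≡⟨ solve 4 (λ s P I B → con 0ℚ :* s :* P :* I :* B := con 0ℚ) refl (sgn k) P I B ⟩
  0ℚ                           ∎
  where
  P = ℕ→ℚ (poch (p ℕ.+ 1) k)
  I = inv (k ℕ.+ p ℕ.+ 1)
  B = pB n (p ℕ.+ k)

stir2Sum-suc : ∀ p n m →
  sumTo m (stir2Summand p (stir2 p m) (suc n)) ≡ sumTo (suc m) (stir2Summand p (stir2 p (suc m)) n)
stir2Sum-suc p n m = begin
  sumTo m (stir2Summand p S (suc n))
    ≡⟨ sumTo-cong m (stir2Summand-suc p S n) ⟩
  sumTo m (λ k → U k + V (suc k))
    ≡⟨ sumTo-regroup m U V U-top (stir2Summand-vanish p (prev S) n 0 refl) ⟨
  sumTo (suc m) (λ k → U k + V k)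
    ≡⟨ sumTo-cong (suc m) recombine ⟩
  sumTo (suc m) (stir2Summand p (stir2 p (suc m)) n)
    ∎
  where
  S = stir2 p m
  U V : ℕ → ℚ
  U k = ℕ→ℚ (k ℕ.+ p) * stir2Summand p S n k
  V k = stir2Summand p (prev S) n k

  U-top : U (suc m) ≡ 0ℚ
  U-top = trans (cong (ℕ→ℚ (suc m ℕ.+ p) *_) (stir2Summand-vanish p S n (suc m) (stir2-vanish p m (suc m) (ℕP.n<1+n m))))
                (ℚP.*-zeroʳ (ℕ→ℚ (suc m ℕ.+ p)))

  recombine : ∀ k → U k + V k ≡ stir2Summand p (stir2 p (suc m)) n k
  recombine k = begin
    ℕ→ℚ (k ℕ.+ p) * (S k * s * P * I * B) + prev S k * s * P * I * B
      ≡⟨ solve 7 (λ A a b s P I B → A :* (a :* s :* P :* I :* B) :+ b :* s :* P :* I :* B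
                    := (A :* a :+ b) :* s :* P :* I :* B) refl
           (ℕ→ℚ (k ℕ.+ p)) (S k) (prev S k) s P I B ⟩
    (ℕ→ℚ (k ℕ.+ p) * S k + prev S k) * s * P * I * B
      ≡⟨ cong (λ a → a * s * P * I * B) (stir2-suc p m k) ⟨
    stir2 p (suc m) k * s * P * I * B
      ∎
    where
    s = sgn k
    P = ℕ→ℚ (poch (p ℕ.+ 1) k)
    I = inv (k ℕ.+ p ℕ.+ 1)
    B = pB n (p ℕ.+ k)

pB-stirling2 : ∀ p m n → pB (n ℕ.+ m) p ≡ ℕ→ℚ (p ℕ.+ 1) * sumTo m (stir2Summand p (stir2 p m) n)
pB-stirling2 p zero n = begin
  pB (n ℕ.+ 0) p
    ≡⟨ cong (λ i → pB i p) (ℕP.+-identityʳ n) ⟩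
  pB n p
    ≡⟨ ℚP.*-identityˡ (pB n p) ⟨
  1ℚ * pB n p
    ≡⟨ cong (_* pB n p) (ℕ→ℚ*inv (suc p)) ⟨
  ℕ→ℚ (suc p) * inv (suc p) * pB n p
    ≡⟨ solve 3 (λ Y i B → Y :* i :* B := Y :* (con 1ℚ :* i :* B)) refl (ℕ→ℚ (suc p)) (inv (suc p)) (pB n p) ⟩
  ℕ→ℚ (suc p) * (1ℚ * inv (suc p) * pB n p)
    ≡⟨ cong₂ (λ a b → ℕ→ℚ a * (1ℚ * inv a * pB n b)) (ℕP.+-comm 1 p) (sym (ℕP.+-identityʳ p)) ⟩
  ℕ→ℚ (p ℕ.+ 1) * stir2Summand p (stir2 p 0) n 0
    ∎
pB-stirling2 p (suc m) n = begin
  pB (n ℕ.+ suc m) p                                          ≡⟨ cong (λ i → pB i p) (ℕP.+-suc n m) ⟩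
  pB (suc n ℕ.+ m) p                                          ≡⟨ pB-stirling2 p m (suc n) ⟩
  ℕ→ℚ (p ℕ.+ 1) * sumTo m (stir2Summand p (stir2 p m) (suc n))  ≡⟨ cong (ℕ→ℚ (p ℕ.+ 1) *_) (stir2Sum-suc p n m) ⟩
  ℕ→ℚ (p ℕ.+ 1) * sumTo (suc m) (stir2Summand p (stir2 p (suc m)) n) ∎

stir1Summand : ℕ → (ℕ → ℚ) → ℕ → ℕ → ℚ
stir1Summand r c n k = c k * sgn k * pB (n ℕ.+ k) r

stir1Sum : ℕ → ℕ → ℕ → ℚ
stir1Sum r p n = sumTo p (stir1Summand r (stir1 r p) n)

stir1Sum-suc : ∀ r p n → stir1Sum r (suc p) n ≡ ℕ→ℚ (r ℕ.+ p) * stir1Sum r p n - stir1Sum r p (suc n)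
stir1Sum-suc r p n = begin
  stir1Sum r (suc p) n
    ≡⟨ sumTo-cong (suc p) split ⟩
  sumTo (suc p) (λ k → U k + V k)
    ≡⟨ sumTo-regroup p U V U-top (ℚP.*-zeroˡ (pB (n ℕ.+ 0) r)) ⟩
  sumTo p (λ k → U k + V (suc k))
    ≡⟨ sumTo-cong p (λ k → cong (U k +_) (V-shift k)) ⟩
  sumTo p (λ k → ℕ→ℚ (r ℕ.+ p) * stir1Summand r S n k - stir1Summand r S (suc n) k)
    ≡⟨ sumTo-sub p (λ k → ℕ→ℚ (r ℕ.+ p) * stir1Summand r S n k) (stir1Summand r S (suc n)) ⟩
  sumTo p (λ k → ℕ→ℚ (r ℕ.+ p) * stir1Summand r S n k) - stir1Sum r p (suc n)
    ≡⟨ cong (_- stir1Sum r p (suc n)) (sumTo-*ˡ p (ℕ→ℚ (r ℕ.+ p)) (stir1Summand r S n)) ⟩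
  ℕ→ℚ (r ℕ.+ p) * stir1Sum r p n - stir1Sum r p (suc n)
    ∎
  where
  S = stir1 r p
  U V : ℕ → ℚ
  U k = ℕ→ℚ (r ℕ.+ p) * stir1Summand r S n k
  V k = stir1Summand r (prev S) n k

  split : ∀ k → stir1Summand r (stir1 r (suc p)) n k ≡ U k + V k
  split k = begin
    stir1 r (suc p) k * sgn k * pB (n ℕ.+ k) r
      ≡⟨ cong (λ a → a * sgn k * pB (n ℕ.+ k) r) (stir1-suc r p k) ⟩
    (ℕ→ℚ (r ℕ.+ p) * S k + prev S k) * sgn k * pB (n ℕ.+ k) r
      ≡⟨ solve 5 (λ A a b s B → (A :* a :+ b) :* s :* B := A :* (a :* s :* B) :+ b :* s :* B) refl
           (ℕ→ℚ (r ℕ.+ p)) (S k) (prev S k) (sgn k) (pB (n ℕ.+ k) r) ⟩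
    U k + V k
      ∎

  U-top : U (suc p) ≡ 0ℚ
  U-top = begin
    ℕ→ℚ (r ℕ.+ p) * (S (suc p) * sgn (suc p) * pB (n ℕ.+ suc p) r)
      ≡⟨ cong (λ a → ℕ→ℚ (r ℕ.+ p) * (a * sgn (suc p) * pB (n ℕ.+ suc p) r))
           (stir1-vanish r p (suc p) (ℕP.n<1+n p)) ⟩
    ℕ→ℚ (r ℕ.+ p) * (0ℚ * sgn (suc p) * pB (n ℕ.+ suc p) r)
      ≡⟨ solve 3 (λ A s B → A :* (con 0ℚ :* s :* B) := con 0ℚ) refl
           (ℕ→ℚ (r ℕ.+ p)) (sgn (suc p)) (pB (n ℕ.+ suc p) r) ⟩
    0ℚ
      ∎

  V-shift : ∀ k → V (suc k) ≡ - stir1Summand r S (suc n) k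
  V-shift k = begin
    S k * - sgn k * pB (n ℕ.+ suc k) r
      ≡⟨ cong (λ i → S k * - sgn k * pB i r) (ℕP.+-suc n k) ⟩
    S k * - sgn k * pB (suc n ℕ.+ k) r
      ≡⟨ solve 3 (λ a s B → a :* (:- s) :* B := :- (a :* s :* B)) refl (S k) (sgn k) (pB (suc n ℕ.+ k) r) ⟩
    - stir1Summand r S (suc n) k
      ∎

κProd : ℕ → ℕ → ℚ
κProd r zero    = 1ℚ
κProd r (suc p) = κProd r p * κ (p ℕ.+ r)

stir1Sum≡κProd*pB : ∀ r p n → stir1Sum r p n ≡ κProd r p * pB n (p ℕ.+ r)
stir1Sum≡κProd*pB r zero n = cong (λ i → 1ℚ * pB i r) (ℕP.+-identityʳ n)
stir1Sum≡κProd*pB r (suc p) n = begin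
  stir1Sum r (suc p) n
    ≡⟨ stir1Sum-suc r p n ⟩
  ℕ→ℚ (r ℕ.+ p) * stir1Sum r p n - stir1Sum r p (suc n)
    ≡⟨ cong₂ (λ a b → ℕ→ℚ a * b - stir1Sum r p (suc n)) (ℕP.+-comm r p) (stir1Sum≡κProd*pB r p n) ⟩
  ℕ→ℚ q * (K * B) - stir1Sum r p (suc n)
    ≡⟨ cong (λ b → ℕ→ℚ q * (K * B) - b) (trans (stir1Sum≡κProd*pB r p (suc n)) (cong (K *_) (pB-suc n q))) ⟩
  ℕ→ℚ q * (K * B) - K * (ℕ→ℚ q * B - κ q * B′)
    ≡⟨ solve 5 (λ Q K B c B′ → Q :* (K :* B) :- K :* (Q :* B :- c :* B′) := K :* c :* B′) refl
         (ℕ→ℚ q) K B (κ q) B′ ⟩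
  κProd r (suc p) * pB n (suc p ℕ.+ r)
    ∎
  where
  q = p ℕ.+ r
  K = κProd r p
  B = pB n q
  B′ = pB n (suc q)

κProd-closed : ∀ r p →
  κProd r p * ℕ→ℚ (r ℕ.* (p ℕ.+ r ℕ.+ 1)) ≡ ℕ→ℚ ((r ℕ.+ 1) ℕ.* poch r (p ℕ.+ 1))
κProd-closed r zero =
  trans (ℚP.*-identityˡ _) (cong ℕ→ℚ (trans (ℕP.*-comm r (r ℕ.+ 1)) (cong ((r ℕ.+ 1) ℕ.*_) r≡poch)))
  where
  r≡poch : r ≡ 1 ℕ.* (r ℕ.+ 0)
  r≡poch = sym (trans (ℕP.*-identityˡ (r ℕ.+ 0)) (ℕP.+-identityʳ r))
κProd-closed r (suc p) = begin
  κProd r p * (Y * Y * Z) * ℕ→ℚ (r ℕ.* (suc p ℕ.+ r ℕ.+ 1))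
    ≡⟨ cong (κProd r p * (Y * Y * Z) *_) (r-factor (suc p)) ⟩
  κProd r p * (Y * Y * Z) * (R * W)
    ≡⟨ solve 5 (λ K Y Z R W → K :* (Y :* Y :* Z) :* (R :* W) := K :* (R :* Y) :* Y :* (W :* Z)) refl
         (κProd r p) Y Z R W ⟩
  κProd r p * (R * Y) * Y * (W * Z)
    ≡⟨ cong₂ (λ a b → a * Y * b)
         (trans (cong (κProd r p *_) (sym (r-factor p))) (κProd-closed r p)) (ℕ→ℚ*inv (suc (suc q))) ⟩
  N * Y * 1ℚ
    ≡⟨ ℚP.*-identityʳ (N * Y) ⟩
  N * Y
    ≡⟨ N-expand ⟨
  ℕ→ℚ ((r ℕ.+ 1) ℕ.* poch r (suc p ℕ.+ 1))
    ∎
  where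
  q = p ℕ.+ r
  R = ℕ→ℚ r
  Y = ℕ→ℚ (suc q)
  W = ℕ→ℚ (suc (suc q))
  Z = inv (suc (suc q))
  N = ℕ→ℚ ((r ℕ.+ 1) ℕ.* poch r (p ℕ.+ 1))

  r-factor : ∀ p → ℕ→ℚ (r ℕ.* (p ℕ.+ r ℕ.+ 1)) ≡ R * ℕ→ℚ (suc (p ℕ.+ r))
  r-factor p = trans (cong (λ a → ℕ→ℚ (r ℕ.* a)) (ℕP.+-comm (p ℕ.+ r) 1)) (ℕ→ℚ-* r (suc (p ℕ.+ r)))

  r+[p+1]≡1+q : r ℕ.+ (p ℕ.+ 1) ≡ suc q
  r+[p+1]≡1+q = trans (cong (r ℕ.+_) (ℕP.+-comm p 1)) (trans (ℕP.+-suc r p) (cong suc (ℕP.+-comm r p)))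

  N-expand : ℕ→ℚ ((r ℕ.+ 1) ℕ.* poch r (suc p ℕ.+ 1)) ≡ N * Y
  N-expand = begin
    ℕ→ℚ ((r ℕ.+ 1) ℕ.* (poch r (p ℕ.+ 1) ℕ.* (r ℕ.+ (p ℕ.+ 1))))
      ≡⟨ cong ℕ→ℚ (ℕP.*-assoc (r ℕ.+ 1) (poch r (p ℕ.+ 1)) (r ℕ.+ (p ℕ.+ 1))) ⟨
    ℕ→ℚ ((r ℕ.+ 1) ℕ.* poch r (p ℕ.+ 1) ℕ.* (r ℕ.+ (p ℕ.+ 1)))
      ≡⟨ ℕ→ℚ-* ((r ℕ.+ 1) ℕ.* poch r (p ℕ.+ 1)) (r ℕ.+ (p ℕ.+ 1)) ⟩
    N * ℕ→ℚ (r ℕ.+ (p ℕ.+ 1))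
      ≡⟨ cong (λ a → N * ℕ→ℚ a) r+[p+1]≡1+q ⟩
    N * Y
      ∎

pB-stirling1 : ∀ n r p → 1 ≤ r →
  pB n (p ℕ.+ r) ≡ ℕ→ℚ (r ℕ.* (p ℕ.+ r ℕ.+ 1)) * inv ((r ℕ.+ 1) ℕ.* poch r (p ℕ.+ 1)) * stir1Sum r p n
pB-stirling1 n r@(suc r′) p _ = sym (begin
  M * inv N * stir1Sum r p n       ≡⟨ cong (M * inv N *_) (stir1Sum≡κProd*pB r p n) ⟩
  M * inv N * (κProd r p * B)      ≡⟨ solve 4 (λ M i K B → M :* i :* (K :* B) := K :* M :* i :* B) refl
                                        M (inv N) (κProd r p) B ⟩
  κProd r p * M * inv N * B        ≡⟨ cong (λ a → a * inv N * B) (κProd-closed r p) ⟩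
  ℕ→ℚ N * inv N * B                ≡⟨ cong (_* B) (ℕ→ℚ*inv N) ⟩
  1ℚ * B                           ≡⟨ ℚP.*-identityˡ B ⟩
  B                                ∎)
  where
  M = ℕ→ℚ (r ℕ.* (p ℕ.+ r ℕ.+ 1))
  N = (r ℕ.+ 1) ℕ.* poch r (p ℕ.+ 1)
  B = pB n (p ℕ.+ r)

  instance
    N-nonZero : NonZero N
    N-nonZero = ℕP.m*n≢0 (r ℕ.+ 1) (poch r (p ℕ.+ 1)) {{_}} {{poch-suc-nonZero r′ (p ℕ.+ 1)}}

theorem3p10 :
    ((n p m : ℕ) →
      pB (n ℕ.+ m) p
        ≡ ℕ→ℚ (p ℕ.+ 1)
          * sumTo m (λ k → stir2 p m k * sgn k * ℕ→ℚ (poch (p ℕ.+ 1) k)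
                           * inv (k ℕ.+ p ℕ.+ 1) * pB n (p ℕ.+ k)))
    ×
    ((n r p : ℕ) → 1 ≤ n → 1 ≤ r →
      pB n (p ℕ.+ r)
        ≡ ℕ→ℚ (r ℕ.* (p ℕ.+ r ℕ.+ 1)) * inv ((r ℕ.+ 1) ℕ.* poch r (p ℕ.+ 1))
          * sumTo p (λ k → stir1 r p k * sgn k * pB (n ℕ.+ k) r))
theorem3p10 = (λ n p m → pB-stirling2 p m n) , (λ n r p _ → pB-stirling1 n r p)
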